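{- Let $H$ be a graph with a function $f:V(H)\to\mathbb Z$, and let $\mathcal H$ be a subgraph partition of $H$. A part $H_i\in\mathcal H$ is an $f$-weak part of $\mathcal H$ if: $H_i$ is obtained from a star $K_{1,t}$ with center $x$ and a set $R$ of $t\in\{0,1,2,3\}$ leaves by possibly adding edges between distinct leaves; $f(x)\ge\deg_H(x)-1$; $f(r)\ge\deg_H(r)+1$ for each $r\in R$; and $x$ has a neighbor in at least $5-t$ distinct parts of $\mathcal H\setminus\{H_i\}$.
   Context: All graphs are finite and simple. A subgraph partition of $H$ is a family $\mathcal H$ of induced subgraphs of $H$ whose vertex sets partition $V(H)$. For $g:V(X)\to\mathbb Z$, a $g$-assignment on $X$ assigns each $v$ a set $L(v)\subseteq\mathbb N$ with $|L(v)|=\max\{0,g(v)\}$; an $L$-coloring is a proper coloring $\phi$ with $\phi(v)\in L(v)$; $X$ is $g$-choosable if it has an $L$-coloring for every $g$-assignment $L$. For a list assignment $L$ on $X$: (FIX') holds if for every $v$ and $c\in L(v)$ some $L$-coloring has $\phi(v)=c$; (FORB-2) holds if for every $v_1,v_2\in V(X)$ (not necessarily distinct) and every $c\in L(v_1)\cup L(v_2)$ some $L$-coloring has $\phi(v_1)\ne c\ne\phi(v_2)$. For $U\subseteq V(H)$, $f^U:V(H)\setminus U\to\mathbb Z$ is $f^U(v)=f(v)-|N_H(v)\cap U|$, and $f^X=f^{V(X)}$ for a subgraph $X$. A part $H_i\in\mathcal H$ is $f$-weak if (1) for every $f|_{V(H_i)}$-assignment on $H_i$, (FIX') and (FORB-2)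 hold; and (2) for every pair $H_j,H_{j'}\in\mathcal H\setminus\{H_i\}$, $H_i$ is $f^{H_j\cup H_{j'}}|_{V(H_i)}$-choosable. -}

module Defs where

open import Data.Nat using (ℕ; _≤_; _+_)
open import Data.Integer using (ℤ; +_; _-_; _⊔_) renaming (_≤_ to _≤ℤ_)
open import Data.Fin using (Fin; _≟_)
open import Data.List using (List; length; filter; allFin)
open import Data.List.Membership.Propositional using (_∈_; _∉_)
open import Data.List.Relation.Unary.All using (All)
open import Data.List.Relation.Unary.Unique.Propositional using (Unique)
open import Data.Product using (Σ; ∃; _×_; _,_)
open import Data.Product.Properties using ()
open import Data.Sum using (_⊎_)
open import Relation.Nullary using (¬_; Dec)
open import Relation.Nullary.Decidable using (_⊎-dec_; _×-dec_)
open import Relation.Binary using (Decidable; Symmetric; Irreflexive)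
open import Relation.Binary.PropositionalEquality using (_≡_; _≢_)
open import Relation.Unary using (Pred)
open import Level using (0ℓ)

record Graph (n : ℕ) : Set₁ where
  field
    Adj   : Fin n → Fin n → Set
    adj?  : Decidable Adj
    sym   : Symmetric Adj
    irrefl : Irreflexive _≡_ Adj
open Graph public

module _ {n : ℕ} (H : Graph n) where

  nbrCountIn : (U : Fin n → Set) → ((u : Fin n) → Dec (U u)) → Fin n → ℕ
  nbrCountIn U U? v = length (filter (λ u → adj? H v u ×-dec U? u) (allFin n))

  deg : Fin n → ℕ
  deg v = length (filter (adj? H v) (allFin n))

  -- Colorings of the induced subgraph H[S] (S given as a predicate on V(H)).
  -- Lists L v for v ∈ S and colorings φ are only consulted on S.
  IsLColoring : (S : Fin n → Set) → (Fin n → List ℕ) → (Fin n → ℕ) → Set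
  IsLColoring S L φ =
    (∀ v → S v → φ v ∈ L v) ×
    (∀ u v → S u → S v → Adj H u v → φ u ≢ φ v)

  -- g-assignment on H[S]: each v ∈ S gets a set (duplicate-free list) of
  -- naturals of size max{0, g(v)}.
  IsAssignment : (S : Fin n → Set) → (Fin n → ℤ) → (Fin n → List ℕ) → Set
  IsAssignment S g L = ∀ v → S v → Unique (L v) × (+ length (L v) ≡ g v ⊔ + 0)

  Choosable : (S : Fin n → Set) → (Fin n → ℤ) → Set
  Choosable S g = ∀ L → IsAssignment S g L → ∃ λ φ → IsLColoring S L φ

  FIX' : (S : Fin n → Set) → (Fin n → List ℕ) → Set
  FIX' S L = ∀ v → S v → ∀ c → c ∈ L v →
    ∃ λ φ → IsLColoring S L φ × φ v ≡ c

  FORB-2 : (S : Fin n → Set) → (Fin n → List ℕ) → Set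
  FORB-2 S L = ∀ v₁ v₂ → S v₁ → S v₂ → ∀ c → (c ∈ L v₁ ⊎ c ∈ L v₂) →
    ∃ λ φ → IsLColoring S L φ × φ v₁ ≢ c × φ v₂ ≢ c

  -- A subgraph partition of H with k parts: part v is the index of the part
  -- containing v; every part is nonempty. Part H_i is the induced subgraph
  -- H[{v | part v ≡ i}].
  module _ {k : ℕ} (part : Fin n → Fin k) where

    InPart : Fin k → Fin n → Set
    InPart i v = part v ≡ i

    fMinus : (Fin n → ℤ) → Fin k → Fin k → Fin n → ℤ
    fMinus f j j' v =
      f v - + nbrCountIn (λ u → part u ≡ j ⊎ part u ≡ j')
                         (λ u → (part u ≟ j) ⊎-dec (part u ≟ j')) v

    IsFWeak : (Fin n → ℤ) → Fin k → Set
    IsFWeak f i =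
      (∀ L → IsAssignment (InPart i) f L →
          FIX' (InPart i) L × FORB-2 (InPart i) L) ×
      (∀ j j' → j ≢ i → j' ≢ i → j ≢ j' →
          Choosable (InPart i) (fMinus f j j'))

    WeakStarHyp : (Fin n → ℤ) → Fin k → Set
    WeakStarHyp f i =
      Σ (Fin n) λ x → Σ (List (Fin n)) λ R →
        -- H_i is a star K_{1,t} with centre x and leaf set R, t = |R| ≤ 3,
        -- possibly with extra edges between leaves (H_i is induced)
        Unique R × length R ≤ 3 × x ∉ R ×
        (∀ v → (part v ≡ i) → (v ≡ x ⊎ v ∈ R)) ×
        (∀ v → (v ≡ x ⊎ v ∈ R) → part v ≡ i) ×
        All (Adj H x) R ×
        (+ deg x - + 1 ≤ℤ f x) ×
        All (λ r → + (deg r + 1) ≤ℤ f r) R ×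
        (Σ (List (Fin k)) λ js → Unique js × 5 ≤ length js + length R ×
           All (λ j → j ≢ i × ∃ λ u → Adj H x u × part u ≡ j) js)

{-# OPTIONS --safe #-}

-- Hᵢ is the star with centre x and leaves R, |R| ≤ 3. As x is adjacent to all of R and to
-- vertices of at least 5 − |R| further parts, deg x ≥ 5, so an f-assignment gives x at least 4
-- colours, and a leaf r gets deg r + 1 colours: every vertex has more colours than neighbours in
-- Hᵢ, so greedy colouring in any order succeeds. For (FIX') the fixed vertex is coloured first;
-- for (FORB-2) the vertices losing the colour c are coloured first, a leaf before the centre.
-- Removing two other parts Hⱼ, Hⱼ′ leaves x at least f(x) − (deg x − 3) ≥ 2 colours, since x keeps
-- its leaves and neighbours in at least 3 − |R| further parts, and still leaves each leaf more
-- colours than neighbours in Hᵢ; so x is coloured first and then the leaves.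
module Submission where

open import Defs renaming (sym to Adj-sym)
open import Data.Nat using (ℕ; suc; _+_; _≤_; _<_; z≤n; s≤s) renaming (_≟_ to _≟ℕ_)
open import Data.Nat.Properties
  using (≤-trans; <-≤-trans; ≤-pred; ≤-refl; +-monoʳ-≤; +-monoˡ-≤; +-cancelˡ-≤; +-comm; m+n∸n≡m; m≤n+m; <⇒≱; n≤1+n;
         module ≤-Reasoning)
open import Data.Integer using (ℤ; +_; _-_; -_; +≤+) renaming (_≤_ to _≤ℤ_)
import Data.Integer.Properties as ℤ
open import Data.Fin using (Fin; _≟_)
open import Data.List using (List; []; _∷_; _++_; length; filter; map; allFin)
open import Data.List.Properties using (filter-notAll; filter-some; length-filter; length-map; length-++)
open import Data.List.Membership.Propositional using (_∈_; _∉_; find)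
open import Data.List.Membership.Propositional.Properties using (∈-filter⁺; ∈-filter⁻; ∈-map⁺; ∈-allFin)
open import Data.List.Relation.Binary.Subset.Propositional using (_⊆_)
open import Data.List.Relation.Unary.Any using (Any; here; there; any?)
import Data.List.Relation.Unary.Any as Any
open import Data.List.Relation.Unary.All using (All; []; _∷_)
import Data.List.Relation.Unary.All as All
import Data.List.Relation.Unary.All.Properties as All
open import Data.List.Relation.Unary.Unique.Propositional using (Unique; []; _∷_)
import Data.List.Relation.Unary.Unique.Propositional.Properties as Unique
open import Data.Product using (∃; _×_; _,_; proj₁; proj₂)
open import Data.Sum using (_⊎_; inj₁; inj₂)
open import Data.Unit using (⊤; tt)
open import Data.Empty using (⊥)
open import Function using (_∘_; const; Surjective)
open import Data.Vec.Functional using (updateAt)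
open import Data.Vec.Functional.Properties using (updateAt-updates; updateAt-minimal)
import Relation.Unary as U
open import Relation.Nullary using (¬_; yes; no; contradiction)
open import Relation.Nullary.Decidable using (¬?; decidable-stable; _⊎-dec_; _×-dec_)
open import Relation.Binary using (DecidableEquality)
open import Relation.Binary.PropositionalEquality using (_≡_; _≢_; refl; sym; trans; cong; subst)

module _ {A : Set} (_≟ᴬ_ : DecidableEquality A) where

  open import Data.List.Membership.DecPropositional _≟ᴬ_ using (_∈?_)

  unique⊆⇒length≤ : ∀ {xs ys : List A} → Unique xs → xs ⊆ ys → length xs ≤ length ys
  unique⊆⇒length≤ {[]}     _              _     = z≤n
  unique⊆⇒length≤ {x ∷ xs} {ys} (x∉xs ∷ uxs) xs⊆ys =
    <-≤-trans (s≤s (unique⊆⇒length≤ uxs xs⊆ys-x)) (filter-notAll (λ y → ¬? (y ≟ᴬ x)) ys x∈ys)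
    where
    x∈ys : Any (λ y → ¬ ¬ y ≡ x) ys
    x∈ys = Any.map (λ x≡y y≢x → y≢x (sym x≡y)) (xs⊆ys (here refl))
    xs⊆ys-x : xs ⊆ filter (λ y → ¬? (y ≟ᴬ x)) ys
    xs⊆ys-x {y} y∈xs = ∈-filter⁺ _ (xs⊆ys (there y∈xs)) λ y≡x → All.lookup x∉xs y∈xs (sym y≡x)

  pigeonhole : ∀ {xs ys : List A} → Unique xs → length ys < length xs → ∃ λ c → c ∈ xs × c ∉ ys
  pigeonhole {xs} {ys} uxs ys<xs with any? (λ c → ¬? (c ∈? ys)) xs
  ... | yes c∉ys = find c∉ys
  ... | no  ¬c∉ys = contradiction (unique⊆⇒length≤ uxs xs⊆ys) (<⇒≱ ys<xs)
    where
    xs⊆ys : xs ⊆ ys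
    xs⊆ys {c} c∈xs = decidable-stable (c ∈? ys) (All.lookup (All.¬Any⇒All¬ xs ¬c∉ys) c∈xs)

  length≤suc-length-filter-≢ : ∀ c {xs : List A} → Unique xs →
                               length xs ≤ suc (length (filter (λ a → ¬? (a ≟ᴬ c)) xs))
  length≤suc-length-filter-≢ c {xs} uxs = unique⊆⇒length≤ uxs xs⊆c∷rest
    where
    xs⊆c∷rest : xs ⊆ c ∷ filter (λ a → ¬? (a ≟ᴬ c)) xs
    xs⊆c∷rest {a} a∈xs with a ≟ᴬ c
    ... | yes a≡c = here a≡c
    ... | no  a≢c = there (∈-filter⁺ _ a∈xs a≢c)

module _ {A : Set} where

  unique-++⁺-separated : ∀ {P : A → Set} {xs ys} → Unique xs → Unique ys → All P xs → All (¬_ ∘ P) ys →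
                         Unique (xs ++ ys)
  unique-++⁺-separated uxs uys Pxs ¬Pys =
    Unique.++⁺ uxs uys λ (v∈xs , v∈ys) → All.lookup ¬Pys v∈ys (All.lookup Pxs v∈xs)

  preimages : ∀ {B : Set} (g : A → B) {P : A → Set} {bs} → All (λ b → ∃ λ a → P a × g a ≡ b) bs →
              ∃ λ as → map g as ≡ bs × All P as
  preimages g []                       = [] , refl , []
  preimages g ((a , Pa , refl) ∷ rest) with preimages g rest
  ... | as , refl , Pas = a ∷ as , refl , Pa ∷ Pas

+[a+b]≤g⇒+a≤g-b : ∀ {a} b {g} → + (a + b) ≤ℤ g → + a ≤ℤ g - + b
+[a+b]≤g⇒+a≤g-b {a} b {g} a+b≤g = subst (_≤ℤ g - + b) a+b-b≡a (ℤ.+-monoˡ-≤ (- + b) a+b≤g)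
  where
  a+b-b≡a : + (a + b) - + b ≡ + a
  a+b-b≡a = trans (ℤ.[+m]-[+n]≡m⊖n (a + b) b) (trans (ℤ.⊖-≥ (m≤n+m b a)) (cong +_ (m+n∸n≡m a b)))

module _ {n : ℕ} (G : Graph n) where

  length≤deg : ∀ {v A} → Unique A → All (Adj G v) A → length A ≤ deg G v
  length≤deg uA adjA =
    unique⊆⇒length≤ _≟_ uA λ u∈A → ∈-filter⁺ (adj? G _) (∈-allFin _) (All.lookup adjA u∈A)

  length-filter-adj≤deg : ∀ {v S} → Unique S → length (filter (adj? G v) S) ≤ deg G v
  length-filter-adj≤deg {v} {S} uS = length≤deg (Unique.filter⁺ (adj? G v) uS) (All.all-filter (adj? G v) S)

  length-filter-adj-mono : ∀ {v B S} → Unique B → B ⊆ S → length (filter (adj? G v) B) ≤ length (filter (adj? G v) S)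
  length-filter-adj-mono {v} uB B⊆S = unique⊆⇒length≤ _≟_ (Unique.filter⁺ (adj? G v) uB) λ u∈ →
    let u∈B , vu = ∈-filter⁻ (adj? G v) u∈ in ∈-filter⁺ (adj? G v) (B⊆S u∈B) vu

  assignment-unique : ∀ {S g L v} → IsAssignment G S g L → S v → Unique (L v)
  assignment-unique asg Sv = proj₁ (asg _ Sv)

  assignment-length : ∀ {S g L v m} → IsAssignment G S g L → S v → + m ≤ℤ g v → m ≤ length (L v)
  assignment-length {g = g} {L} {v} asg Sv m≤g = ℤ.drop‿+≤+ (subst (_ ≤ℤ_) (sym len≡g) m≤g)
    where
    len≡g : + length (L v) ≡ g v
    len≡g = trans (proj₂ (asg _ Sv)) (ℤ.i≥j⇒i⊔j≡i (ℤ.≤-trans (+≤+ z≤n) m≤g))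

  IsLColoring-mono : ∀ {S S' L φ} → (∀ {v} → S' v → S v) → IsLColoring G S L φ → IsLColoring G S' L φ
  IsLColoring-mono S'⊆S (inL , proper) = (λ v → inL v ∘ S'⊆S) , λ u v S'u S'v → proper u v (S'⊆S S'u) (S'⊆S S'v)

module GreedyColouring {n : ℕ} (G : Graph n) (L : Fin n → List ℕ) where

  open import Data.List.Membership.DecPropositional (_≟_ {n}) using (_∈?_)

  Slack : List (Fin n) → Fin n → Set
  Slack S v = Unique (L v) × length (filter (adj? G v) S) < length (L v)

  GreedyOrder : List (Fin n) → List (Fin n) → Set
  GreedyOrder done []         = ⊤
  GreedyOrder done (v ∷ todo) = v ∉ done × Slack done v × GreedyOrder (v ∷ done) todo

  uncoloured : IsLColoring G (_∈ []) L (const 0)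
  uncoloured = (λ _ ()) , λ _ _ ()

  colour-next : ∀ {done φ v c} → v ∉ done → IsLColoring G (_∈ done) L φ →
                c ∈ L v → c ∉ map φ (filter (adj? G v) done) →
                IsLColoring G (_∈ v ∷ done) L (updateAt φ v (const c))
  colour-next {done} {φ} {v} {c} v∉done (inL , proper) c∈Lv c-free = inL′ , proper′
    where
    ψ : Fin n → ℕ
    ψ = updateAt φ v (const c)
    ψv≡c : ψ v ≡ c
    ψv≡c = updateAt-updates v φ
    ψ≡φ : ∀ {u} → u ∈ done → ψ u ≡ φ u
    ψ≡φ {u} u∈done = updateAt-minimal u v φ λ { refl → v∉done u∈done }
    c≢nbr : ∀ {w} → w ∈ done → Adj G v w → c ≢ φ w
    c≢nbr w∈done vw c≡φw = c-free (subst (_∈ _) (sym c≡φw) (∈-map⁺ φ (∈-filter⁺ (adj? G v) w∈done vw)))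
    inL′ : ∀ u → u ∈ v ∷ done → ψ u ∈ L u
    inL′ u (here refl)    = subst (_∈ L v) (sym ψv≡c) c∈Lv
    inL′ u (there u∈done) = subst (_∈ L u) (sym (ψ≡φ u∈done)) (inL u u∈done)
    proper′ : ∀ u w → u ∈ v ∷ done → w ∈ v ∷ done → Adj G u w → ψ u ≢ ψ w
    proper′ u w (here refl) (here refl) uw _  = irrefl G refl uw
    proper′ u w (here refl) (there w∈)  uw eq = c≢nbr w∈ uw (trans (sym ψv≡c) (trans eq (ψ≡φ w∈)))
    proper′ u w (there u∈)  (here refl) uw eq =
      c≢nbr u∈ (Adj-sym G uw) (trans (sym ψv≡c) (trans (sym eq) (ψ≡φ u∈)))
    proper′ u w (there u∈)  (there w∈)  uw eq =
      proper u w u∈ w∈ uw (trans (sym (ψ≡φ u∈)) (trans eq (ψ≡φ w∈)))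

  greedy-extend : ∀ {φ} done todo → IsLColoring G (_∈ done) L φ → GreedyOrder done todo →
                  ∃ λ ψ → IsLColoring G (λ u → u ∈ done ⊎ u ∈ todo) L ψ
  greedy-extend {φ} done [] colouring tt =
    φ , IsLColoring-mono G (λ { (inj₁ u∈done) → u∈done ; (inj₂ ()) }) colouring
  greedy-extend {φ} done (v ∷ todo) colouring (v∉done , (uLv , nbrs<Lv) , order)
    with pigeonhole _≟ℕ_ uLv (subst (_< length (L v)) (sym (length-map φ (filter (adj? G v) done))) nbrs<Lv)
  ... | c , c∈Lv , c-free with greedy-extend (v ∷ done) todo (colour-next v∉done colouring c∈Lv c-free) order
  ... | ψ , colouring′ = ψ , IsLColoring-mono G reassoc colouring′
    where
    reassoc : ∀ {u} → u ∈ done ⊎ u ∈ v ∷ todo → u ∈ v ∷ done ⊎ u ∈ todo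
    reassoc (inj₁ u∈done)         = inj₁ (there u∈done)
    reassoc (inj₂ (here u≡v))     = inj₁ (here u≡v)
    reassoc (inj₂ (there u∈todo)) = inj₂ u∈todo

  greedyOrder-slack : ∀ {S done todo} → Unique done → Unique todo → (∀ {v} → v ∈ todo → v ∉ done) →
                      done ⊆ S → todo ⊆ S → All (Slack S) todo → GreedyOrder done todo
  greedyOrder-slack {todo = []} _ _ _ _ _ _ = tt
  greedyOrder-slack {S} {done} {v ∷ todo} udone (v∉todo ∷ utodo) disjoint done⊆S todo⊆S ((uLv , v-slack) ∷ slack) =
    disjoint (here refl) , (uLv , ≤-trans (s≤s (length-filter-adj-mono G udone done⊆S)) v-slack) ,
    greedyOrder-slack (All.¬Any⇒All¬ done (disjoint (here refl)) ∷ udone) utodo disjoint′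
                      v∷done⊆S (todo⊆S ∘ there) slack
    where
    disjoint′ : ∀ {u} → u ∈ todo → u ∉ v ∷ done
    disjoint′ u∈todo (here u≡v)     = All.lookup v∉todo u∈todo (sym u≡v)
    disjoint′ u∈todo (there u∈done) = disjoint (there u∈todo) u∈done
    v∷done⊆S : v ∷ done ⊆ S
    v∷done⊆S (here refl)    = todo⊆S (here refl)
    v∷done⊆S (there u∈done) = done⊆S u∈done

  colour-greedily : ∀ {S} pre → Unique S → Unique pre → pre ⊆ S → GreedyOrder [] pre →
                    (∀ {w} → w ∈ S → w ∉ pre → Slack S w) → ∃ λ φ → IsLColoring G (_∈ S) L φ
  colour-greedily {S} pre uS upre pre⊆S pre-order slack =
    let φ , colour-pre = greedy-extend [] pre uncoloured pre-order
        ψ , colour-all = greedy-extend pre rest (IsLColoring-mono G inj₂ colour-pre) rest-order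
    in ψ , IsLColoring-mono G cover colour-all
    where
    rest : List (Fin n)
    rest = filter (λ w → ¬? (w ∈? pre)) S
    rest-order : GreedyOrder pre rest
    rest-order = greedyOrder-slack upre (Unique.filter⁺ _ uS) (λ w∈rest → proj₂ (∈-filter⁻ _ {xs = S} w∈rest))
      pre⊆S (λ w∈rest → proj₁ (∈-filter⁻ _ {xs = S} w∈rest))
      (All.tabulate λ w∈rest → let w∈S , w∉pre = ∈-filter⁻ _ {xs = S} w∈rest in slack w∈S w∉pre)
    cover : ∀ {u} → u ∈ S → u ∈ pre ⊎ u ∈ rest
    cover {u} u∈S with u ∈? pre
    ... | yes u∈pre = inj₁ u∈pre
    ... | no  u∉pre = inj₂ (∈-filter⁺ _ u∈S u∉pre)

module _ {n : ℕ} {T : Fin n → Set} (T? : U.Decidable T) {P : ℕ → Set} (P? : U.Decidable P) (L : Fin n → List ℕ) where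

  restrictAt : Fin n → List ℕ
  restrictAt w with T? w
  ... | yes _ = filter P? (L w)
  ... | no  _ = L w

  restrictAt-inside : ∀ {w} → T w → restrictAt w ≡ filter P? (L w)
  restrictAt-inside {w} Tw with T? w
  ... | yes _   = refl
  ... | no  ¬Tw = contradiction Tw ¬Tw

  restrictAt-outside : ∀ {w} → ¬ T w → restrictAt w ≡ L w
  restrictAt-outside {w} ¬Tw with T? w
  ... | yes Tw = contradiction Tw ¬Tw
  ... | no  _  = refl

  restrictAt-slack-inside : ∀ (G : Graph n) {S w} → T w → Unique (L w) →
                            length (filter (adj? G w) S) < length (filter P? (L w)) → GreedyColouring.Slack G restrictAt S w
  restrictAt-slack-inside G {S} {w} Tw uLw room =
    subst (λ l → Unique l × length (filter (adj? G w) S) < length l) (sym (restrictAt-inside Tw))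
      (Unique.filter⁺ P? uLw , room)

  restrictAt-slack-outside : ∀ (G : Graph n) {S w} → ¬ T w →
                             GreedyColouring.Slack G L S w → GreedyColouring.Slack G restrictAt S w
  restrictAt-slack-outside G {S} {w} ¬Tw =
    subst (λ l → Unique l × length (filter (adj? G w) S) < length l) (sym (restrictAt-outside ¬Tw))

  restrictAt-colouring : ∀ (G : Graph n) {S φ} → IsLColoring G S restrictAt φ →
                         IsLColoring G S L φ × (∀ w → S w → T w → P (φ w))
  restrictAt-colouring G (inL , proper) = ((λ w → ⊆L ∘ inL w) , proper) , λ w Sw Tw →
    proj₂ (∈-filter⁻ P? {xs = L w} (subst (_ ∈_) (restrictAt-inside Tw) (inL w Sw)))
    where
    ⊆L : ∀ {w} → restrictAt w ⊆ L w
    ⊆L {w} c∈ with T? w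
    ... | yes _ = proj₁ (∈-filter⁻ P? c∈)
    ... | no  _ = c∈

module WeakStar {n k : ℕ} (H : Graph n) (f : Fin n → ℤ) (part : Fin n → Fin k) (i : Fin k)
  (x : Fin n) (R : List (Fin n)) (uR : Unique R) (|R|≤3 : length R ≤ 3) (x∉R : x ∉ R)
  (part≡i⇒ : ∀ v → part v ≡ i → v ≡ x ⊎ v ∈ R) (⇒part≡i : ∀ v → v ≡ x ⊎ v ∈ R → part v ≡ i)
  (x-adj-R : All (Adj H x) R) (f-centre : + deg H x - + 1 ≤ℤ f x)
  (f-leaves : All (λ r → + (deg H r + 1) ≤ℤ f r) R)
  (js : List (Fin k)) (ujs : Unique js) (5≤js+R : 5 ≤ length js + length R)
  (x-sees-js : All (λ j → j ≢ i × ∃ λ u → Adj H x u × part u ≡ j) js) where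

  module GC = GreedyColouring H

  S : List (Fin n)
  S = x ∷ R

  uS : Unique S
  uS = All.¬Any⇒All¬ R x∉R ∷ uR

  ∈S⇒part≡i : ∀ {v} → v ∈ S → part v ≡ i
  ∈S⇒part≡i (here v≡x)  = ⇒part≡i _ (inj₁ v≡x)
  ∈S⇒part≡i (there v∈R) = ⇒part≡i _ (inj₂ v∈R)

  part≡i⇒∈S : ∀ {v} → part v ≡ i → v ∈ S
  part≡i⇒∈S {v} v∈Hᵢ with part≡i⇒ v v∈Hᵢ
  ... | inj₁ v≡x = here v≡x
  ... | inj₂ v∈R = there v∈R

  colouring-of-part : ∀ {L φ} → IsLColoring H (_∈ S) L φ → IsLColoring H (InPart H part i) L φ
  colouring-of-part = IsLColoring-mono H part≡i⇒∈S

  leaf : ∀ {v} → v ∈ S → v ≢ x → v ∈ R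
  leaf (here v≡x)  v≢x = contradiction v≡x v≢x
  leaf (there v∈R) _   = v∈R

  centre-nbrs≤3 : length (filter (adj? H x) S) ≤ 3
  centre-nbrs≤3 = ≤-trans (unique⊆⇒length≤ _≟_ (Unique.filter⁺ (adj? H x) uS) nbrs⊆R) |R|≤3
    where
    nbrs⊆R : filter (adj? H x) S ⊆ R
    nbrs⊆R u∈ = let u∈S , xu = ∈-filter⁻ (adj? H x) {xs = S} u∈ in leaf u∈S λ u≡x → irrefl H (sym u≡x) xu

  leaf-nbrs-before-centre : ∀ {r B} → r ∈ R → Unique B → B ⊆ S → x ∉ B →
                            suc (length (filter (adj? H r) B)) ≤ length (filter (adj? H r) S)
  leaf-nbrs-before-centre {r} {B} r∈R uB B⊆S x∉B = unique⊆⇒length≤ _≟_ unique ⊆nbrs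
    where
    unique : Unique (x ∷ filter (adj? H r) B)
    unique = All.¬Any⇒All¬ _ (x∉B ∘ proj₁ ∘ ∈-filter⁻ (adj? H r) {xs = B}) ∷ Unique.filter⁺ (adj? H r) uB
    ⊆nbrs : x ∷ filter (adj? H r) B ⊆ filter (adj? H r) S
    ⊆nbrs (here refl) = ∈-filter⁺ (adj? H r) (here refl) (Adj-sym H (All.lookup x-adj-R r∈R))
    ⊆nbrs (there u∈)  = let u∈B , ru = ∈-filter⁻ (adj? H r) {xs = B} u∈ in ∈-filter⁺ (adj? H r) (B⊆S u∈B) ru

  nbrs-in-S+outside≤deg : ∀ {v C} → Unique C → All (Adj H v) C → All (λ u → part u ≢ i) C →
                          length (filter (adj? H v) S) + length C ≤ deg H v
  nbrs-in-S+outside≤deg {v} {C} uC adjC outside =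
    subst (_≤ deg H v) (length-++ (filter (adj? H v) S))
      (length≤deg H (unique-++⁺-separated (Unique.filter⁺ (adj? H v) uS) uC inside outside)
                    (All.++⁺ (All.all-filter (adj? H v) S) adjC))
    where
    inside : All (λ u → part u ≡ i) (filter (adj? H v) S)
    inside = All.tabulate (∈S⇒part≡i ∘ proj₁ ∘ ∈-filter⁻ (adj? H v) {xs = S})

  centre-degree : (Q : Fin k → Set) → ¬ Q i →
                  ∀ {C} → Unique C → All (Adj H x) C → All (Q ∘ part) C →
                  ∀ {js′} → Unique js′ → All (¬_ ∘ Q) js′ →
                  All (λ j → j ≢ i × ∃ λ u → Adj H x u × part u ≡ j) js′ →
                  length C + (length R + length js′) ≤ deg H x
  centre-degree Q ¬Qi {C} uC adjC QC ujs′ ¬Qjs′ sees with preimages part (All.map proj₂ sees)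
  ... | us , refl , adj-us = begin
    length C + (length R + length (map part us)) ≡⟨ cong (λ m → length C + (length R + m)) (length-map part us) ⟩
    length C + (length R + length us)            ≡⟨ cong (λ m → length C + m) (sym (length-++ R)) ⟩
    length C + length (R ++ us)                  ≡⟨ sym (length-++ C) ⟩
    length (C ++ R ++ us)                        ≤⟨ length≤deg H unique (All.++⁺ adjC (All.++⁺ x-adj-R adj-us)) ⟩
    deg H x                                      ∎
    where
    open ≤-Reasoning
    R-inside : All (λ u → part u ≡ i) R
    R-inside = All.tabulate (∈S⇒part≡i ∘ there)
    us-outside : All (λ u → part u ≢ i) us
    us-outside = All.map⁻ (All.map proj₁ sees)
    ¬Q-R++us : All (¬_ ∘ Q ∘ part) (R ++ us)
    ¬Q-R++us = All.++⁺ (All.map (λ part≡i → ¬Qi ∘ subst Q part≡i) R-inside) (All.map⁻ ¬Qjs′)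
    unique : Unique (C ++ R ++ us)
    unique = unique-++⁺-separated uC (unique-++⁺-separated uR (Unique.map⁻ ujs′) R-inside us-outside) QC ¬Q-R++us

  5≤centre-degree : 5 ≤ deg H x
  5≤centre-degree = begin
    5                         ≤⟨ 5≤js+R ⟩
    length js + length R      ≡⟨ +-comm (length js) (length R) ⟩
    length R + length js      ≤⟨ centre-degree (λ _ → ⊥) (λ ()) [] [] [] ujs (All.tabulate λ _ ()) x-sees-js ⟩
    deg H x                   ∎
    where open ≤-Reasoning

  module _ (L : Fin n → List ℕ) (asg : IsAssignment H (InPart H part i) f L) where

    unique-lists : ∀ {w} → w ∈ S → Unique (L w)
    unique-lists = assignment-unique H asg ∘ ∈S⇒part≡i

    4≤centre-colours : 4 ≤ length (L x)
    4≤centre-colours = assignment-length H asg (∈S⇒part≡i (here refl))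
      (ℤ.≤-trans (+[a+b]≤g⇒+a≤g-b 1 (+≤+ 5≤centre-degree)) f-centre)

    leaf-colours : ∀ {r} → r ∈ R → suc (deg H r) ≤ length (L r)
    leaf-colours {r} r∈R = subst (_≤ length (L r)) (+-comm (deg H r) 1)
      (assignment-length H asg (∈S⇒part≡i (there r∈R)) (All.lookup f-leaves r∈R))

    slack : ∀ {w} → w ∈ S → GC.Slack L S w
    slack (here refl)   = unique-lists (here refl) , ≤-trans (s≤s centre-nbrs≤3) 4≤centre-colours
    slack (there r∈R)   = unique-lists (there r∈R) , ≤-trans (s≤s (length-filter-adj≤deg H uS)) (leaf-colours r∈R)

    restricted-colouring : ∀ {T P} (T? : U.Decidable T) (P? : U.Decidable P) pre → Unique pre → pre ⊆ S →
                           (∀ {w} → T w → w ∈ pre) → GC.GreedyOrder (restrictAt T? P? L) [] pre →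
                           ∃ λ φ → IsLColoring H (InPart H part i) L φ × (∀ {w} → T w → P (φ w))
    restricted-colouring T? P? pre upre pre⊆S T⊆pre order =
      let φ , colouring = GC.colour-greedily (restrictAt T? P? L) pre uS upre pre⊆S order slack′
          colouringL , restricted = restrictAt-colouring T? P? L H colouring
      in φ , colouring-of-part colouringL , λ Tw → restricted _ (pre⊆S (T⊆pre Tw)) Tw
      where
      slack′ : ∀ {w} → w ∈ S → w ∉ pre → GC.Slack (restrictAt T? P? L) S w
      slack′ w∈S w∉pre = restrictAt-slack-outside T? P? L H {S} (w∉pre ∘ T⊆pre) (slack w∈S)

    fix′ : FIX' H (InPart H part i) L
    fix′ v v∈Hᵢ c c∈Lv =
      let φ , colouring , fixed = restricted-colouring T? P? (v ∷ []) ([] ∷ []) (λ { (here refl) → v∈S })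
                                    (λ { refl → here refl }) ((λ ()) , v-slack , tt)
      in φ , colouring , fixed refl
      where
      v∈S : v ∈ S
      v∈S = part≡i⇒∈S v∈Hᵢ
      T? : U.Decidable (_≡ v)
      T? = _≟ v
      P? : U.Decidable (_≡ c)
      P? = _≟ℕ c
      v-slack : GC.Slack (restrictAt T? P? L) [] v
      v-slack = restrictAt-slack-inside T? P? L H {[]} refl (unique-lists v∈S) (filter-some P? (Any.map sym c∈Lv))

    is-either? : (v₁ v₂ : Fin n) → U.Decidable (λ u → u ≡ v₁ ⊎ u ≡ v₂)
    is-either? v₁ v₂ u = (u ≟ v₁) ⊎-dec (u ≟ v₂)

    is-not? : (c : ℕ) → U.Decidable (_≢ c)
    is-not? c a = ¬? (a ≟ℕ c)

    avoiding : Fin n → Fin n → ℕ → Fin n → List ℕ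
    avoiding v₁ v₂ c = restrictAt (is-either? v₁ v₂) (is-not? c) L

    avoiding-colouring : ∀ {v₁ v₂} c pre → Unique pre → pre ⊆ S → v₁ ∈ pre → v₂ ∈ pre →
                         GC.GreedyOrder (avoiding v₁ v₂ c) [] pre →
                         ∃ λ φ → IsLColoring H (InPart H part i) L φ × φ v₁ ≢ c × φ v₂ ≢ c
    avoiding-colouring {v₁} {v₂} c pre upre pre⊆S v₁∈pre v₂∈pre order =
      let φ , colouring , avoided = restricted-colouring (is-either? v₁ v₂) (is-not? c) pre upre pre⊆S
                                      (λ { (inj₁ refl) → v₁∈pre ; (inj₂ refl) → v₂∈pre }) order
      in φ , colouring , avoided (inj₁ refl) , avoided (inj₂ refl)

    -- One colour may be removed: the centre has at least 4 colours and at most 1 coloured neighbour,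
    -- and a leaf r has deg r + 1 colours while its neighbour x is still uncoloured.
    avoiding-slack : ∀ {v₁ v₂ c w B} → w ≡ v₁ ⊎ w ≡ v₂ → w ∈ S →
                     Unique B → B ⊆ S → x ∉ B → length B ≤ 1 →
                     GC.Slack (avoiding v₁ v₂ c) B w
    avoiding-slack {v₁} {v₂} {c} {w} {B} Tw w∈S uB B⊆S x∉B |B|≤1 =
      restrictAt-slack-inside (is-either? v₁ v₂) (is-not? c) L H {B} Tw (unique-lists w∈S)
        (≤-pred (≤-trans (two-spare w∈S) (length≤suc-length-filter-≢ _≟ℕ_ c (unique-lists w∈S))))
      where
      two-spare : ∀ {w} → w ∈ S → suc (suc (length (filter (adj? H w) B))) ≤ length (L w)
      two-spare (here refl) =
        ≤-trans (+-monoʳ-≤ 2 (≤-trans (length-filter (adj? H x) B) |B|≤1)) (≤-trans (n≤1+n 3) 4≤centre-colours)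
      two-spare {r} (there r∈R) =
        ≤-trans (s≤s (≤-trans (leaf-nbrs-before-centre r∈R uB B⊆S x∉B) (length-filter-adj≤deg H uS)))
                (leaf-colours r∈R)

    forb-leaf-first : ∀ c {a₁ a₂} → a₁ ∈ S → a₂ ∈ S → a₁ ≢ a₂ → a₁ ≢ x →
                      ∃ λ φ → IsLColoring H (InPart H part i) L φ × φ a₁ ≢ c × φ a₂ ≢ c
    forb-leaf-first c a₁∈S a₂∈S a₁≢a₂ a₁≢x =
      avoiding-colouring c (_ ∷ _ ∷ []) ((a₁≢a₂ ∷ []) ∷ [] ∷ [])
        (λ { (here refl) → a₁∈S ; (there (here refl)) → a₂∈S })
        (here refl) (there (here refl))
        ((λ ()) , avoiding-slack (inj₁ refl) a₁∈S [] (λ ()) (λ ()) z≤n ,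
         (λ { (here a₂≡a₁) → a₁≢a₂ (sym a₂≡a₁) }) ,
         avoiding-slack (inj₂ refl) a₂∈S ([] ∷ []) (λ { (here refl) → a₁∈S })
           (λ { (here x≡a₁) → a₁≢x (sym x≡a₁) }) ≤-refl ,
         tt)

    forb-2 : FORB-2 H (InPart H part i) L
    forb-2 v₁ v₂ v₁∈Hᵢ v₂∈Hᵢ c _ with v₁ ≟ v₂ | v₁ ≟ x
    ... | yes refl | _ =
      avoiding-colouring c (v₁ ∷ []) ([] ∷ []) (λ { (here refl) → v₁∈S }) (here refl) (here refl)
        ((λ ()) , avoiding-slack (inj₁ refl) v₁∈S [] (λ ()) (λ ()) z≤n , tt)
      where
      v₁∈S = part≡i⇒∈S v₁∈Hᵢ
    ... | no v₁≢v₂ | yes refl =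
      let φ , colouring , φv₂≢c , φx≢c = forb-leaf-first c (part≡i⇒∈S v₂∈Hᵢ) (here refl) v₂≢x v₂≢x
      in φ , colouring , φx≢c , φv₂≢c
      where
      v₂≢x : v₂ ≢ x
      v₂≢x v₂≡x = v₁≢v₂ (sym v₂≡x)
    ... | no v₁≢v₂ | no v₁≢x = forb-leaf-first c (part≡i⇒∈S v₁∈Hᵢ) (part≡i⇒∈S v₂∈Hᵢ) v₁≢v₂ v₁≢x

  module _ (j j′ : Fin k) (j≢i : j ≢ i) (j′≢i : j′ ≢ i) where

    Removed : Fin k → Set
    Removed l = l ≡ j ⊎ l ≡ j′

    removed? : U.Decidable Removed
    removed? l = (l ≟ j) ⊎-dec (l ≟ j′)

    i-not-removed : ¬ Removed i
    i-not-removed (inj₁ i≡j)  = j≢i (sym i≡j)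
    i-not-removed (inj₂ i≡j′) = j′≢i (sym i≡j′)

    removed-nbrs : Fin n → List (Fin n)
    removed-nbrs v = filter (λ u → adj? H v u ×-dec removed? (part u)) (allFin n)

    removed-nbrs-unique : ∀ {v} → Unique (removed-nbrs v)
    removed-nbrs-unique = Unique.filter⁺ _ (Unique.allFin⁺ n)

    removed-nbrs-adj : ∀ {v} → All (λ u → Adj H v u × Removed (part u)) (removed-nbrs v)
    removed-nbrs-adj {v} = All.all-filter (λ u → adj? H v u ×-dec removed? (part u)) (allFin n)

    centre-removed-nbrs : length (removed-nbrs x) + 3 ≤ deg H x
    centre-removed-nbrs = begin
      length (removed-nbrs x) + 3                     ≤⟨ +-monoʳ-≤ (length (removed-nbrs x)) 3≤R+js′ ⟩
      length (removed-nbrs x) + (length R + length js′) ≤⟨ centre-degree Removed i-not-removed removed-nbrs-unique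
                                                             (All.map proj₁ removed-nbrs-adj) (All.map proj₂ removed-nbrs-adj)
                                                             (Unique.filter⁺ _ ujs) (All.all-filter (¬? ∘ removed?) js)
                                                             (All.filter⁺ (¬? ∘ removed?) x-sees-js) ⟩
      deg H x                                         ∎
      where
      open ≤-Reasoning
      js′ : List (Fin k)
      js′ = filter (¬? ∘ removed?) js
      js⊆ : js ⊆ j ∷ j′ ∷ js′
      js⊆ {l} l∈js with removed? l
      ... | yes (inj₁ l≡j)  = here l≡j
      ... | yes (inj₂ l≡j′) = there (here l≡j′)
      ... | no  ¬removed-l         = there (there (∈-filter⁺ (¬? ∘ removed?) l∈js ¬removed-l))
      3≤R+js′ : 3 ≤ length R + length js′
      3≤R+js′ = +-cancelˡ-≤ 2 3 (length R + length js′) (begin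
        5                            ≤⟨ 5≤js+R ⟩
        length js + length R         ≤⟨ +-monoˡ-≤ (length R) (unique⊆⇒length≤ _≟_ ujs js⊆) ⟩
        2 + (length js′ + length R)  ≡⟨ cong (λ m → 2 + m) (+-comm (length js′) (length R)) ⟩
        2 + (length R + length js′)  ∎)

    choosable : Choosable H (InPart H part i) (fMinus H part f j j′)
    choosable L asg =
      let φ , colouring = GC.colour-greedily L (x ∷ []) uS ([] ∷ []) (λ { (here refl) → here refl })
                            ((λ ()) , (assignment-unique H asg x∈Hᵢ , centre-colour) , tt) slack′
      in φ , colouring-of-part colouring
      where
      x∈Hᵢ : part x ≡ i
      x∈Hᵢ = ∈S⇒part≡i (here refl)
      centre-colour : 1 ≤ length (L x)
      centre-colour = assignment-length H asg x∈Hᵢ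
        (+[a+b]≤g⇒+a≤g-b (length (removed-nbrs x)) (ℤ.≤-trans (+[a+b]≤g⇒+a≤g-b 1 (+≤+ room)) f-centre))
        where
        open ≤-Reasoning
        room : suc (length (removed-nbrs x)) + 1 ≤ deg H x
        room = begin
          suc (length (removed-nbrs x)) + 1 ≡⟨ +-comm (suc (length (removed-nbrs x))) 1 ⟩
          2 + length (removed-nbrs x)       ≤⟨ n≤1+n _ ⟩
          3 + length (removed-nbrs x)       ≡⟨ +-comm 3 (length (removed-nbrs x)) ⟩
          length (removed-nbrs x) + 3       ≤⟨ centre-removed-nbrs ⟩
          deg H x                           ∎
      slack′ : ∀ {w} → w ∈ S → w ∉ x ∷ [] → GC.Slack L S w
      slack′ (here refl) x∉[x] = contradiction (here refl) x∉[x]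
      slack′ {r} (there r∈R) _ =
        assignment-unique H asg r∈Hᵢ ,
        assignment-length H asg r∈Hᵢ
          (+[a+b]≤g⇒+a≤g-b (length (removed-nbrs r)) (ℤ.≤-trans (+≤+ room) (All.lookup f-leaves r∈R)))
        where
        r∈Hᵢ : part r ≡ i
        r∈Hᵢ = ∈S⇒part≡i (there r∈R)
        outside : All (λ u → part u ≢ i) (removed-nbrs r)
        outside = All.map (λ (_ , removed-part-u) part-u≡i → i-not-removed (subst Removed part-u≡i removed-part-u))
                          removed-nbrs-adj
        room : suc (length (filter (adj? H r) S)) + length (removed-nbrs r) ≤ deg H r + 1
        room = subst (suc (length (filter (adj? H r) S)) + length (removed-nbrs r) ≤_) (+-comm 1 (deg H r))
                 (s≤s (nbrs-in-S+outside≤deg removed-nbrs-unique (All.map proj₁ removed-nbrs-adj) outside))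

lemma3p10 : {n k : ℕ} (H : Graph n) (f : Fin n → ℤ) (part : Fin n → Fin k) →
    Surjective _≡_ _≡_ part → (i : Fin k) →
    WeakStarHyp H part f i → IsFWeak H part f i
lemma3p10 H f part _ i
  (x , R , uR , |R|≤3 , x∉R , part≡i⇒ , ⇒part≡i , x-adj-R , f-centre , f-leaves , js , ujs , 5≤js+R , x-sees-js) =
  (λ L asg → fix′ L asg , forb-2 L asg) ,
  (λ j j′ j≢i j′≢i _ → choosable j j′ j≢i j′≢i)
  where
  open WeakStar H f part i x R uR |R|≤3 x∉R part≡i⇒ ⇒part≡i x-adj-R f-centre f-leaves js ujs 5≤js+R x-sees-js
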